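{- Let $\ell\ge 1$ and let $G_1,\dots,G_\ell$ be finite graphs on the same vertex set $V$, where $G_i$ has $m_i$ edges. Then there is a bipartition of $V$ into two classes $A$ and $B$ such that for all $i=1,\dots,\ell$, $$e_{G_i}(A,B)\ge \frac{m_i}{2}-\sqrt{\ell m_i/2}.$$
   Context: Graphs are finite and simple. For disjoint subsets $A,B$ of the vertex set of a graph $G$, $e_G(A,B)$ denotes the number of edges of $G$ with one endvertex in $A$ and the other in $B$. A bipartition of $V$ means a pair of disjoint sets $A,B$ with $A\cup B=V$ (classes are allowed to be empty). -}

module Defs where

open import Data.Nat using (ℕ; zero; suc; _+_; _<ᵇ_)
open import Data.Bool using (Bool; true; false; if_then_else_; _∧_; _xor_)
open import Data.Fin using (Fin; toℕ)
open import Data.List using (List; []; _∷_; [_]; concatMap; allFin)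
open import Data.Product using (_×_; _,_)
open import Relation.Binary.PropositionalEquality using (_≡_)

record Graph (n : ℕ) : Set where
  field
    adj    : Fin n → Fin n → Bool
    sym    : ∀ i j → adj i j ≡ adj j i
    irrefl : ∀ i → adj i i ≡ false
open Graph public

count : {A : Set} → (A → Bool) → List A → ℕ
count f [] = 0
count f (x ∷ xs) = (if f x then 1 else 0) + count f xs

pairs : (n : ℕ) → List (Fin n × Fin n)
pairs n = concatMap (λ i → concatMap (λ j → if toℕ i <ᵇ toℕ j then [ (i , j) ] else []) (allFin n)) (allFin n)

edges : {n : ℕ} → Graph n → ℕ
edges {n} G = count (λ { (i , j) → adj G i j }) (pairs n)

-- A bipartition (A , B) of Fin n is given by its indicator: A = {v | side v ≡ true}, B = complement.
-- e_G(A,B): number of edges with one endpoint in each class.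
cut : {n : ℕ} → Graph n → (Fin n → Bool) → ℕ
cut {n} G side = count (λ { (i , j) → adj G i j ∧ (side i xor side j) }) (pairs n)

{-# OPTIONS --safe #-}
module Submission where

-- Encode a bipartition by spins s ∈ {±1}ⁿ. Then e(G) − 2·e_G(A,B) = Σ_{ij ∈ E(G)} sᵢsⱼ is a
-- multilinear polynomial in s with 0/1 coefficients, one per edge, so by Parseval its square
-- sums to 2ⁿ·e(G) over all 2ⁿ bipartitions. Weighting graph i by 1/(mᵢ+1) (denominators
-- cleared by the product of the mᵢ+1), the weighted sum of the squared deficits averages at
-- most ℓ, so some bipartition has (mᵢ − 2e_{Gᵢ}(A,B))² ≤ ℓ(mᵢ+1) ≤ 2ℓmᵢ for every i at once.

open import Data.Bool using (Bool; true; false)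
open import Data.Fin using (Fin; zero; suc)
open import Data.Vec.Functional using (Vector; head; tail)
open import Function using (_∘_)
open import Algebra.Bundles using (Semiring)

module Sums {c r} (R : Semiring c r) where
  open import Data.Nat using (zero; suc)
  open import Data.Vec.Functional using ([]; _∷_)
  open Semiring R
  open import Algebra.Properties.CommutativeSemigroup +-commutativeSemigroup using (interchange)
  open import Relation.Binary.Reasoning.Setoid setoid

  open import Algebra.Properties.Semiring.Sum R public

  sumAll : ∀ n → (Vector Bool n → Carrier) → Carrier
  sumAll zero    f = f []
  sumAll (suc n) f = sumAll n (f ∘ (true ∷_)) + sumAll n (f ∘ (false ∷_))

  sumAll-cong : ∀ n {f g : Vector Bool n → Carrier} → (∀ s → f s ≈ g s) → sumAll n f ≈ sumAll n g
  sumAll-cong zero    f≈g = f≈g []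
  sumAll-cong (suc n) f≈g = +-cong (sumAll-cong n (f≈g ∘ (true ∷_))) (sumAll-cong n (f≈g ∘ (false ∷_)))

  sumAll-distrib-+ : ∀ n (f g : Vector Bool n → Carrier) →
                     sumAll n (λ s → f s + g s) ≈ sumAll n f + sumAll n g
  sumAll-distrib-+ zero    f g = refl
  sumAll-distrib-+ (suc n) f g = begin
    sumAll n (λ s → f (true ∷ s) + g (true ∷ s)) + sumAll n (λ s → f (false ∷ s) + g (false ∷ s))
      ≈⟨ +-cong (sumAll-distrib-+ n _ _) (sumAll-distrib-+ n _ _) ⟩
    (sumAll n (f ∘ (true ∷_)) + sumAll n (g ∘ (true ∷_)))
      + (sumAll n (f ∘ (false ∷_)) + sumAll n (g ∘ (false ∷_)))
      ≈⟨ interchange _ _ _ _ ⟩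
    sumAll (suc n) f + sumAll (suc n) g ∎

  *-distribˡ-sumAll : ∀ n x (f : Vector Bool n → Carrier) → x * sumAll n f ≈ sumAll n (λ s → x * f s)
  *-distribˡ-sumAll zero    x f = refl
  *-distribˡ-sumAll (suc n) x f =
    trans (distribˡ x _ _) (+-cong (*-distribˡ-sumAll n x _) (*-distribˡ-sumAll n x _))

  sumAll-sum-comm : ∀ n {k} (f : Fin k → Vector Bool n → Carrier) →
                    sumAll n (λ s → sum (λ i → f i s)) ≈ sum (λ i → sumAll n (f i))
  sumAll-sum-comm zero    f = refl
  sumAll-sum-comm (suc n) f = begin
    sumAll n (λ s → sum (λ i → f i (true ∷ s))) + sumAll n (λ s → sum (λ i → f i (false ∷ s)))
      ≈⟨ +-cong (sumAll-sum-comm n (λ i → f i ∘ (true ∷_)))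
                (sumAll-sum-comm n (λ i → f i ∘ (false ∷_))) ⟩
    sum (λ i → sumAll n (f i ∘ (true ∷_))) + sum (λ i → sumAll n (f i ∘ (false ∷_)))
      ≈⟨ ∑-distrib-+ (λ i → sumAll n (f i ∘ (true ∷_))) (λ i → sumAll n (f i ∘ (false ∷_))) ⟨
    sum (λ i → sumAll (suc n) (f i)) ∎

module MultilinearPolynomials where
  open import Data.Nat using (ℕ; zero; suc; _^_)
  open import Data.Integer using (ℤ; +_; 0ℤ; 1ℤ; -1ℤ; _+_; _*_)
  open import Data.Integer.Properties
    using (*-commutativeSemigroup; +-*-semiring; pos-*; +-comm; *-comm; +-identityʳ; *-identityˡ; *-zeroʳ)
  open import Data.Integer.Tactic.RingSolver using (solve-∀)
  open import Data.Product using (_×_; _,_)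
  open import Relation.Binary.PropositionalEquality using (_≡_; refl; sym; cong; cong₂; trans; module ≡-Reasoning)
  open ≡-Reasoning
  open Sums +-*-semiring
  open import Algebra.Properties.CommutativeSemigroup *-commutativeSemigroup using (x∙yz≈y∙xz)

  -- (p , q) stands for the polynomial p(s₁,…,sₙ₋₁) + s₀·q(s₁,…,sₙ₋₁) in spins sᵢ = ±1.
  Multilinear : ℕ → Set
  Multilinear zero    = ℤ
  Multilinear (suc n) = Multilinear n × Multilinear n

  spin : Bool → ℤ
  spin true  = 1ℤ
  spin false = -1ℤ

  eval : ∀ {n} → Multilinear n → Vector Bool n → ℤ
  eval {zero}  c       s = c
  eval {suc n} (p , q) s = eval p (tail s) + spin (head s) * eval q (tail s)

  ‖_‖² : ∀ {n} → Multilinear n → ℤ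
  ‖_‖² {zero}  c       = c * c
  ‖_‖² {suc n} (p , q) = ‖ p ‖² + ‖ q ‖²

  parseval : ∀ {n} (p : Multilinear n) →
             sumAll n (λ s → eval p s * eval p s) ≡ + (2 ^ n) * ‖ p ‖²
  parseval {zero}  c       = sym (*-identityˡ (c * c))
  parseval {suc n} (p , q) = begin
    sumAll n (λ s → (P s + 1ℤ * Q s) * (P s + 1ℤ * Q s))
      + sumAll n (λ s → (P s + -1ℤ * Q s) * (P s + -1ℤ * Q s))
      ≡⟨ sumAll-distrib-+ n _ _ ⟨
    sumAll n (λ s → (P s + 1ℤ * Q s) * (P s + 1ℤ * Q s) + (P s + -1ℤ * Q s) * (P s + -1ℤ * Q s))
      ≡⟨ sumAll-cong n (λ s → cross-terms-cancel (P s) (Q s)) ⟩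
    sumAll n (λ s → + 2 * (P s * P s) + + 2 * (Q s * Q s))
      ≡⟨ sumAll-distrib-+ n _ _ ⟩
    sumAll n (λ s → + 2 * (P s * P s)) + sumAll n (λ s → + 2 * (Q s * Q s))
      ≡⟨ cong₂ _+_ (*-distribˡ-sumAll n (+ 2) _) (*-distribˡ-sumAll n (+ 2) _) ⟨
    + 2 * sumAll n (λ s → P s * P s) + + 2 * sumAll n (λ s → Q s * Q s)
      ≡⟨ cong₂ (λ x y → + 2 * x + + 2 * y) (parseval p) (parseval q) ⟩
    + 2 * (+ (2 ^ n) * ‖ p ‖²) + + 2 * (+ (2 ^ n) * ‖ q ‖²)
      ≡⟨ doubling (+ (2 ^ n)) ‖ p ‖² ‖ q ‖² ⟩
    (+ 2 * + (2 ^ n)) * (‖ p ‖² + ‖ q ‖²)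
      ≡⟨ cong (_* (‖ p ‖² + ‖ q ‖²)) (pos-* 2 (2 ^ n)) ⟨
    + (2 ^ suc n) * (‖ p ‖² + ‖ q ‖²) ∎
    where
    P Q : Vector Bool n → ℤ
    P = eval p
    Q = eval q
    cross-terms-cancel : ∀ x y → (x + 1ℤ * y) * (x + 1ℤ * y) + (x + -1ℤ * y) * (x + -1ℤ * y)
                                 ≡ + 2 * (x * x) + + 2 * (y * y)
    cross-terms-cancel = solve-∀
    doubling : ∀ a x y → + 2 * (a * x) + + 2 * (a * y) ≡ (+ 2 * a) * (x + y)
    doubling = solve-∀

  pairSum : ∀ n → (Fin n → Fin n → ℤ) → ℤ
  pairSum zero    a = 0ℤ
  pairSum (suc n) a = sum (λ j → a zero (suc j)) + pairSum n (λ i j → a (suc i) (suc j))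

  pairSum-cong : ∀ n {a b : Fin n → Fin n → ℤ} → (∀ i j → a i j ≡ b i j) → pairSum n a ≡ pairSum n b
  pairSum-cong zero    a≡b = refl
  pairSum-cong (suc n) a≡b =
    cong₂ _+_ (sum-cong-≗ (a≡b zero ∘ suc)) (pairSum-cong n (λ i j → a≡b (suc i) (suc j)))

  constant : ∀ n → ℤ → Multilinear n
  constant zero    c = c
  constant (suc n) c = constant n c , constant n 0ℤ

  linear : ∀ {n} → Vector ℤ n → Multilinear n
  linear {zero}  w = 0ℤ
  linear {suc n} w = linear (tail w) , constant n (head w)

  quadratic : ∀ {n} → (Fin n → Fin n → ℤ) → Multilinear n
  quadratic {zero}  a = 0ℤ
  quadratic {suc n} a = quadratic (λ i j → a (suc i) (suc j)) , linear (a zero ∘ suc)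

  eval-constant : ∀ n c (s : Vector Bool n) → eval (constant n c) s ≡ c
  eval-constant zero    c s = refl
  eval-constant (suc n) c s = begin
    eval (constant n c) (tail s) + spin (head s) * eval (constant n 0ℤ) (tail s)
      ≡⟨ cong₂ (λ x y → x + spin (head s) * y) (eval-constant n c (tail s)) (eval-constant n 0ℤ (tail s)) ⟩
    c + spin (head s) * 0ℤ
      ≡⟨ cong (λ x → c + x) (*-zeroʳ (spin (head s))) ⟩
    c + 0ℤ
      ≡⟨ +-identityʳ c ⟩
    c ∎

  eval-linear : ∀ {n} (w : Vector ℤ n) s → eval (linear w) s ≡ sum (λ j → w j * spin (s j))
  eval-linear {zero}  w s = refl
  eval-linear {suc n} w s = begin
    eval (linear (tail w)) (tail s) + spin (head s) * eval (constant n (head w)) (tail s)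
      ≡⟨ cong₂ (λ x y → x + spin (head s) * y)
               (eval-linear (tail w) (tail s)) (eval-constant n (head w) (tail s)) ⟩
    rest + spin (head s) * head w
      ≡⟨ +-comm rest _ ⟩
    spin (head s) * head w + rest
      ≡⟨ cong (_+ rest) (*-comm (spin (head s)) (head w)) ⟩
    head w * spin (head s) + rest ∎
    where
    rest : ℤ
    rest = sum (λ j → w (suc j) * spin (s (suc j)))

  eval-quadratic : ∀ {n} (a : Fin n → Fin n → ℤ) s →
                   eval (quadratic a) s ≡ pairSum n (λ i j → a i j * (spin (s i) * spin (s j)))
  eval-quadratic {zero}  a s = refl
  eval-quadratic {suc n} a s = begin
    eval (quadratic a′) (tail s) + spin (head s) * eval (linear (a zero ∘ suc)) (tail s)
      ≡⟨ cong₂ (λ x y → x + spin (head s) * y)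
               (eval-quadratic a′ (tail s)) (eval-linear (a zero ∘ suc) (tail s)) ⟩
    rest + spin (head s) * sum (λ j → a zero (suc j) * spin (s (suc j)))
      ≡⟨ +-comm rest _ ⟩
    spin (head s) * sum (λ j → a zero (suc j) * spin (s (suc j))) + rest
      ≡⟨ cong (_+ rest) (*-distribˡ-sum (spin (head s)) (λ j → a zero (suc j) * spin (s (suc j)))) ⟩
    sum (λ j → spin (head s) * (a zero (suc j) * spin (s (suc j)))) + rest
      ≡⟨ cong (_+ rest) (sum-cong-≗ (λ j → x∙yz≈y∙xz (spin (head s)) (a zero (suc j)) (spin (s (suc j))))) ⟩
    sum (λ j → a zero (suc j) * (spin (head s) * spin (s (suc j)))) + rest ∎
    where
    a′ : Fin n → Fin n → ℤ
    a′ i j = a (suc i) (suc j)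
    rest : ℤ
    rest = pairSum n (λ i j → a′ i j * (spin (s (suc i)) * spin (s (suc j))))

  ‖constant‖² : ∀ n c → ‖ constant n c ‖² ≡ c * c
  ‖constant‖² zero    c = refl
  ‖constant‖² (suc n) c = trans (cong₂ _+_ (‖constant‖² n c) (‖constant‖² n 0ℤ)) (+-identityʳ (c * c))

  ‖linear‖² : ∀ {n} (w : Vector ℤ n) → ‖ linear w ‖² ≡ sum (λ j → w j * w j)
  ‖linear‖² {zero}  w = refl
  ‖linear‖² {suc n} w =
    trans (cong₂ _+_ (‖linear‖² (tail w)) (‖constant‖² n (head w)))
          (+-comm (sum (λ j → w (suc j) * w (suc j))) (head w * head w))

  ‖quadratic‖² : ∀ {n} (a : Fin n → Fin n → ℤ) → ‖ quadratic a ‖² ≡ pairSum n (λ i j → a i j * a i j)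
  ‖quadratic‖² {zero}  a = refl
  ‖quadratic‖² {suc n} a =
    trans (cong₂ _+_ (‖quadratic‖² (λ i j → a (suc i) (suc j))) (‖linear‖² (a zero ∘ suc)))
          (+-comm (pairSum n (λ i j → a (suc i) (suc j) * a (suc i) (suc j))) _)

module GraphPolynomial where
  open import Data.Nat as ℕ using (zero; suc; _<ᵇ_)
  open import Data.Integer using (ℤ; +_; 0ℤ; 1ℤ; _+_; _-_; _*_)
  open import Data.Integer.Properties using (+-*-semiring; +-identityˡ; +-identityʳ; +-assoc; *-zeroʳ; pos-+; pos-*)
  open import Data.Integer.Tactic.RingSolver using (solve-∀)
  open import Data.Bool using (if_then_else_; _∧_; _xor_)
  open import Data.Fin using (toℕ)
  open import Data.List using (List; []; _∷_; [_]; _++_; concatMap; allFin; tabulate)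
  open import Data.Product using (_×_; _,_; uncurry)
  open import Function using (id)
  open import Relation.Binary.PropositionalEquality using (_≡_; refl; sym; cong; cong₂; trans; module ≡-Reasoning)
  open ≡-Reasoning
  open import Defs using (Graph; adj; count; pairs; edges; cut)
  open Sums +-*-semiring using (sum; sum-cong-≗)
  open MultilinearPolynomials

  indicator : Bool → ℤ
  indicator true  = 1ℤ
  indicator false = 0ℤ

  listSum : {A : Set} → (A → ℤ) → List A → ℤ
  listSum f []       = 0ℤ
  listSum f (x ∷ xs) = f x + listSum f xs

  listSum-++ : {A : Set} (f : A → ℤ) (xs ys : List A) → listSum f (xs ++ ys) ≡ listSum f xs + listSum f ys
  listSum-++ f []       ys = sym (+-identityˡ (listSum f ys))
  listSum-++ f (x ∷ xs) ys =
    trans (cong (λ y → f x + y) (listSum-++ f xs ys)) (sym (+-assoc (f x) (listSum f xs) (listSum f ys)))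

  listSum-concatMap : {A B : Set} (f : B → ℤ) (g : A → List B) (xs : List A) →
                      listSum f (concatMap g xs) ≡ listSum (listSum f ∘ g) xs
  listSum-concatMap f g []       = refl
  listSum-concatMap f g (x ∷ xs) =
    trans (listSum-++ f (g x) (concatMap g xs)) (cong (λ y → listSum f (g x) + y) (listSum-concatMap f g xs))

  listSum-tabulate : ∀ {A : Set} n (f : A → ℤ) (h : Fin n → A) → listSum f (tabulate h) ≡ sum (f ∘ h)
  listSum-tabulate zero    f h = refl
  listSum-tabulate (suc n) f h = cong (λ y → f (h zero) + y) (listSum-tabulate n f (h ∘ suc))

  count≡listSum : ∀ {A : Set} (f : A → Bool) xs → + count f xs ≡ listSum (indicator ∘ f) xs
  count≡listSum f []       = refl
  count≡listSum f (x ∷ xs) =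
    trans (pos-+ (if f x then 1 else 0) (count f xs)) (cong₂ _+_ (if-indicator (f x)) (count≡listSum f xs))
    where
    if-indicator : ∀ b → + (if b then 1 else 0) ≡ indicator b
    if-indicator true  = refl
    if-indicator false = refl

  listSum-linear : ∀ {A : Set} (f g : A → ℤ) k xs →
                   listSum f xs - k * listSum g xs ≡ listSum (λ x → f x - k * g x) xs
  listSum-linear f g k []       = cong (λ y → 0ℤ - y) (*-zeroʳ k)
  listSum-linear f g k (x ∷ xs) =
    trans (regroup k (f x) (g x) (listSum f xs) (listSum g xs))
          (cong (λ y → f x - k * g x + y) (listSum-linear f g k xs))
    where
    regroup : ∀ k a b c d → (a + c) - k * (b + d) ≡ (a - k * b) + (c - k * d)
    regroup = solve-∀

  upper-sum≡pairSum : ∀ n (a : Fin n → Fin n → ℤ) →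
                      sum (λ i → sum (λ j → if toℕ i <ᵇ toℕ j then a i j else 0ℤ)) ≡ pairSum n a
  upper-sum≡pairSum zero    a = refl
  upper-sum≡pairSum (suc n) a =
    cong₂ _+_ (+-identityˡ (sum (λ j → a zero (suc j))))
              (trans (sum-cong-≗ (λ i → +-identityˡ (upper-row a′ i))) (upper-sum≡pairSum n a′))
    where
    a′ : Fin n → Fin n → ℤ
    a′ i j = a (suc i) (suc j)
    upper-row : (Fin n → Fin n → ℤ) → Fin n → ℤ
    upper-row b i = sum (λ j → if toℕ i <ᵇ toℕ j then b i j else 0ℤ)

  listSum-pairs : ∀ n (a : Fin n → Fin n → ℤ) → listSum (uncurry a) (pairs n) ≡ pairSum n a
  listSum-pairs n a = begin
    listSum (uncurry a) (pairs n)
      ≡⟨ listSum-concatMap (uncurry a) row (allFin n) ⟩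
    listSum (λ i → listSum (uncurry a) (row i)) (allFin n)
      ≡⟨ listSum-tabulate n _ id ⟩
    sum (λ i → listSum (uncurry a) (row i))
      ≡⟨ sum-cong-≗ (λ i → trans (listSum-concatMap (uncurry a) (entry i) (allFin n)) (listSum-tabulate n _ id)) ⟩
    sum (λ i → sum (λ j → listSum (uncurry a) (entry i j)))
      ≡⟨ sum-cong-≗ (λ i → sum-cong-≗ (λ j → listSum-entry i j)) ⟩
    sum (λ i → sum (λ j → if toℕ i <ᵇ toℕ j then a i j else 0ℤ))
      ≡⟨ upper-sum≡pairSum n a ⟩
    pairSum n a ∎
    where
    entry : Fin n → Fin n → List (Fin n × Fin n)
    entry i j = if toℕ i <ᵇ toℕ j then [ (i , j) ] else []
    row : Fin n → List (Fin n × Fin n)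
    row i = concatMap (entry i) (allFin n)
    listSum-entry : ∀ i j → listSum (uncurry a) (entry i j) ≡ (if toℕ i <ᵇ toℕ j then a i j else 0ℤ)
    listSum-entry i j with toℕ i <ᵇ toℕ j
    ... | true  = +-identityʳ (a i j)
    ... | false = refl

  count-pairs : ∀ n (f : Fin n × Fin n → Bool) → + count f (pairs n) ≡ pairSum n (λ i j → indicator (f (i , j)))
  count-pairs n f = trans (count≡listSum f (pairs n)) (listSum-pairs n (λ i j → indicator (f (i , j))))

  edge-spin : ∀ a b c → indicator a - + 2 * indicator (a ∧ (b xor c)) ≡ indicator a * (spin b * spin c)
  edge-spin false b     c     = refl
  edge-spin true  true  true  = refl
  edge-spin true  true  false = refl
  edge-spin true  false true  = refl
  edge-spin true  false false = refl

  indicator-idem : ∀ a → indicator a * indicator a ≡ indicator a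
  indicator-idem true  = refl
  indicator-idem false = refl

  module _ {n} (G : Graph n) where
    cutDeficit : Vector Bool n → ℤ
    cutDeficit side = + edges G - + (2 ℕ.* cut G side)

    graphPolynomial : Multilinear n
    graphPolynomial = quadratic (λ i j → indicator (adj G i j))

    ‖graphPolynomial‖² : ‖ graphPolynomial ‖² ≡ + edges G
    ‖graphPolynomial‖² = begin
      ‖ graphPolynomial ‖²
        ≡⟨ ‖quadratic‖² (λ i j → indicator (adj G i j)) ⟩
      pairSum n (λ i j → indicator (adj G i j) * indicator (adj G i j))
        ≡⟨ pairSum-cong n (λ i j → indicator-idem (adj G i j)) ⟩
      pairSum n (λ i j → indicator (adj G i j))
        ≡⟨ count-pairs n _ ⟨
      + edges G ∎

    eval-graphPolynomial : ∀ side → eval graphPolynomial side ≡ cutDeficit side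
    eval-graphPolynomial side = begin
      eval graphPolynomial side
        ≡⟨ eval-quadratic (λ i j → indicator (adj G i j)) side ⟩
      pairSum n (λ i j → indicator (adj G i j) * (spin (side i) * spin (side j)))
        ≡⟨ pairSum-cong n (λ i j → edge-spin (adj G i j) (side i) (side j)) ⟨
      pairSum n (λ i j → indicator (adj G i j) - + 2 * indicator (isCut i j))
        ≡⟨ listSum-pairs n _ ⟨
      listSum (λ (i , j) → indicator (adj G i j) - + 2 * indicator (isCut i j)) (pairs n)
        ≡⟨ listSum-linear _ _ (+ 2) (pairs n) ⟨
      listSum (λ (i , j) → indicator (adj G i j)) (pairs n)
        - + 2 * listSum (λ (i , j) → indicator (isCut i j)) (pairs n)
        ≡⟨ cong₂ (λ x y → x - + 2 * y) (count≡listSum _ (pairs n)) (count≡listSum _ (pairs n)) ⟨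
      + edges G - + 2 * + cut G side
        ≡⟨ cong (λ y → + edges G - y) (pos-* 2 (cut G side)) ⟨
      cutDeficit side ∎
      where
      isCut : Fin n → Fin n → Bool
      isCut i j = adj G i j ∧ (side i xor side j)

open import Data.Nat using (ℕ; _+_; _*_; _∸_; _^_; _≤_)
open import Data.Bool using (Bool)
open import Data.Fin using (Fin)
open import Data.Product using (Σ)
open import Defs

open import Data.Nat using (zero; suc; _<_; _≤?_; z≤n; s≤s; z<s; >-nonZero)
open import Data.Nat.Properties
  using (+-*-semiring; *-1-commutativeMonoid; *-commutativeSemigroup; ≤-reflexive; ≤-trans; ≰⇒>;
         <⇒≱; +-mono-<; +-mono-≤; m≤m+n; m≤n+m; n≤1+n; m∸n≤m; m≤n⇒m∸n≡0; *-identityˡ; *-identityʳ; *-comm;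
         *-mono-≤; *-monoʳ-≤; *-mono-<; *-cancelˡ-≤; ≤-total; module ≤-Reasoning)
open import Data.Nat.Tactic.RingSolver using (solve-∀)
open import Data.Integer as ℤ using (ℤ; ∣_∣)
import Data.Integer.Properties as ℤₚ
open import Data.Product using (∃-syntax; _,_; proj₁; proj₂)
open import Data.Vec.Functional using ([]; _∷_; removeAt)
open import Data.Fin using (punchIn)
open import Relation.Nullary using (yes; no; contradiction)
open import Data.Sum using (inj₁; inj₂)
open import Relation.Binary.PropositionalEquality using (_≡_; refl; cong; cong₂; trans; module ≡-Reasoning)
  renaming (sym to ≡-sym)
open Sums +-*-semiring
open import Algebra.Properties.CommutativeMonoid.Sum *-1-commutativeMonoid
  using () renaming (sum to product; sum-remove to product-remove)
open import Algebra.Properties.CommutativeSemigroup *-commutativeSemigroup using (x∙yz≈y∙xz)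

sumAll≤⇒∃≤ : ∀ n (f : Vector Bool n → ℕ) K → sumAll n f ≤ 2 ^ n * K → ∃[ s ] f s ≤ K
sumAll≤⇒∃≤ zero    f K ∑f≤ = [] , ≤-trans ∑f≤ (≤-reflexive (*-identityˡ K))
sumAll≤⇒∃≤ (suc n) f K ∑f≤
  with sumAll n (f ∘ (true ∷_)) ≤? 2 ^ n * K | sumAll n (f ∘ (false ∷_)) ≤? 2 ^ n * K
... | yes ∑t≤K | _        = let s , fs≤K = sumAll≤⇒∃≤ n (f ∘ (true ∷_)) K ∑t≤K in true ∷ s , fs≤K
... | no _     | yes ∑f≤K = let s , fs≤K = sumAll≤⇒∃≤ n (f ∘ (false ∷_)) K ∑f≤K in false ∷ s , fs≤K
... | no ∑t≰K  | no ∑f≰K  = contradiction ∑f≤ (<⇒≱ (begin-strict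
  2 ^ suc n * K                                    ≡⟨ doubling (2 ^ n) K ⟩
  2 ^ n * K + 2 ^ n * K                            <⟨ +-mono-< (≰⇒> ∑t≰K) (≰⇒> ∑f≰K) ⟩
  sumAll n (f ∘ (true ∷_)) + sumAll n (f ∘ (false ∷_)) ∎))
  where
  open ≤-Reasoning
  doubling : ∀ a K → (2 * a) * K ≡ a * K + a * K
  doubling = solve-∀

sum-mono-≤ : ∀ {k} {f g : Vector ℕ k} → (∀ i → f i ≤ g i) → sum f ≤ sum g
sum-mono-≤ {zero}  f≤g = z≤n
sum-mono-≤ {suc k} f≤g = +-mono-≤ (f≤g zero) (sum-mono-≤ (f≤g ∘ suc))

sum-const : ∀ k c → sum {k} (λ _ → c) ≡ k * c
sum-const zero    c = refl
sum-const (suc k) c = cong (c +_) (sum-const k c)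

term≤sum : ∀ {k} (f : Vector ℕ k) i → f i ≤ sum f
term≤sum {suc k} f i = ≤-trans (m≤m+n (f i) _) (≤-reflexive (≡-sym (sum-remove f)))

product-positive : ∀ {k} (c : Vector ℕ k) → (∀ i → 0 < c i) → 0 < product c
product-positive {zero}  c c>0 = z<s
product-positive {suc k} c c>0 = *-mono-< (c>0 zero) (product-positive (c ∘ suc) (c>0 ∘ suc))

cofactor : ∀ {k} → Vector ℕ k → Fin k → ℕ
cofactor {suc k} c i = product (removeAt c i)

cofactor-positive : ∀ {k} (c : Vector ℕ k) → (∀ i → 0 < c i) → ∀ i → 0 < cofactor c i
cofactor-positive {suc k} c c>0 i = product-positive (removeAt c i) (c>0 ∘ punchIn i)

cofactor-* : ∀ {k} (c : Vector ℕ k) i → cofactor c i * c i ≡ product c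
cofactor-* {suc k} c i = trans (*-comm (cofactor c i) (c i)) (≡-sym (product-remove c))

simultaneous-markov : ∀ n {k} (f : Fin k → Vector Bool n → ℕ) (c : Vector ℕ k) → (∀ i → 0 < c i) →
                      (∀ i → sumAll n (f i) ≤ 2 ^ n * c i) → ∃[ s ] ∀ i → f i s ≤ k * c i
simultaneous-markov n {k} f c c>0 ∑f≤ = s , f[s]≤
  where
  open ≤-Reasoning
  -- w i = ∏_{j ≠ i} c j = (∏ c)/c i: all k weighted bounds w i * (2 ^ n * c i) become 2 ^ n * ∏ c.
  w : Fin k → ℕ
  w = cofactor c
  weighted : Vector Bool n → ℕ
  weighted s = sum (λ i → w i * f i s)
  ∑weighted≤ : sumAll n weighted ≤ 2 ^ n * (k * product c)
  ∑weighted≤ = begin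
    sumAll n weighted                        ≡⟨ sumAll-sum-comm n (λ i s → w i * f i s) ⟩
    sum (λ i → sumAll n (λ s → w i * f i s)) ≡⟨ sum-cong-≗ (λ i → *-distribˡ-sumAll n (w i) (f i)) ⟨
    sum (λ i → w i * sumAll n (f i))         ≤⟨ sum-mono-≤ (λ i → *-monoʳ-≤ (w i) (∑f≤ i)) ⟩
    sum (λ i → w i * (2 ^ n * c i))          ≡⟨ sum-cong-≗ (λ i → trans (x∙yz≈y∙xz (w i) (2 ^ n) (c i))
                                                                        (cong (2 ^ n *_) (cofactor-* c i))) ⟩
    sum {k} (λ _ → 2 ^ n * product c)        ≡⟨ sum-const k (2 ^ n * product c) ⟩
    k * (2 ^ n * product c)                  ≡⟨ x∙yz≈y∙xz k (2 ^ n) (product c) ⟩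
    2 ^ n * (k * product c)                  ∎
  average : ∃[ s ] weighted s ≤ k * product c
  average = sumAll≤⇒∃≤ n weighted (k * product c) ∑weighted≤
  s : Vector Bool n
  s = proj₁ average
  f[s]≤ : ∀ i → f i s ≤ k * c i
  f[s]≤ i = *-cancelˡ-≤ (w i) {{>-nonZero (cofactor-positive c c>0 i)}} (begin
    w i * f i s         ≤⟨ term≤sum (λ j → w j * f j s) i ⟩
    weighted s          ≤⟨ proj₂ average ⟩
    k * product c       ≡⟨ cong (k *_) (cofactor-* c i) ⟨
    k * (w i * c i)     ≡⟨ x∙yz≈y∙xz k (w i) (c i) ⟩
    w i * (k * c i)     ∎)

module ℤΣ = Sums ℤₚ.+-*-semiring

+-sumAll : ∀ n (f : Vector Bool n → ℕ) → ℤ.+ sumAll n f ≡ ℤΣ.sumAll n (ℤ.+_ ∘ f)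
+-sumAll zero    f = refl
+-sumAll (suc n) f = trans (ℤₚ.pos-+ (sumAll n (f ∘ (true ∷_))) (sumAll n (f ∘ (false ∷_))))
                           (cong₂ ℤ._+_ (+-sumAll n (f ∘ (true ∷_))) (+-sumAll n (f ∘ (false ∷_))))

i*i≡+∣i∣*∣i∣ : ∀ i → i ℤ.* i ≡ ℤ.+ (∣ i ∣ * ∣ i ∣)
i*i≡+∣i∣*∣i∣ (ℤ.+ n)    = ≡-sym (ℤₚ.pos-* n n)
i*i≡+∣i∣*∣i∣ ℤ.-[1+ n ] = refl

open GraphPolynomial using (cutDeficit; graphPolynomial; eval-graphPolynomial; ‖graphPolynomial‖²)
open MultilinearPolynomials using (eval; ‖_‖²; parseval)

sumAll-∣cutDeficit∣² : ∀ {n} (G : Graph n) →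
                       sumAll n (λ s → ∣ cutDeficit G s ∣ * ∣ cutDeficit G s ∣) ≡ 2 ^ n * edges G
sumAll-∣cutDeficit∣² {n} G = ℤₚ.+-injective (begin
  ℤ.+ sumAll n (λ s → ∣ X s ∣ * ∣ X s ∣)
    ≡⟨ +-sumAll n (λ s → ∣ X s ∣ * ∣ X s ∣) ⟩
  ℤΣ.sumAll n (λ s → ℤ.+ (∣ X s ∣ * ∣ X s ∣))
    ≡⟨ ℤΣ.sumAll-cong n (λ s → trans (cong₂ ℤ._*_ (eval-graphPolynomial G s) (eval-graphPolynomial G s))
                                     (i*i≡+∣i∣*∣i∣ (X s))) ⟨
  ℤΣ.sumAll n (λ s → eval P s ℤ.* eval P s)
    ≡⟨ parseval P ⟩
  ℤ.+ (2 ^ n) ℤ.* ‖ P ‖²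
    ≡⟨ cong (ℤ.+ (2 ^ n) ℤ.*_) (‖graphPolynomial‖² G) ⟩
  ℤ.+ (2 ^ n) ℤ.* ℤ.+ edges G
    ≡⟨ ℤₚ.pos-* (2 ^ n) (edges G) ⟨
  ℤ.+ (2 ^ n * edges G) ∎)
  where
  open ≡-Reasoning
  X : Vector Bool n → ℤ
  X = cutDeficit G
  P : MultilinearPolynomials.Multilinear n
  P = graphPolynomial G

m∸n≤∣+m-+n∣ : ∀ m n → m ∸ n ≤ ∣ ℤ.+ m ℤ.- ℤ.+ n ∣
m∸n≤∣+m-+n∣ m n with ≤-total n m
... | inj₁ n≤m = ≤-reflexive (≡-sym (cong ∣_∣ (trans (ℤₚ.[+m]-[+n]≡m⊖n m n) (ℤₚ.⊖-≥ n≤m))))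
... | inj₂ m≤n = ≤-trans (≤-reflexive (m≤n⇒m∸n≡0 m≤n)) z≤n

deficit²-bound : ∀ k {m d y} → d ≤ m → d ≤ y → y * y ≤ k * suc m → d ^ 2 ≤ 2 * k * m
deficit²-bound k {zero}  z≤n _   _   = z≤n
deficit²-bound k {suc m} {d} {y} _ d≤y y²≤ = begin
  d ^ 2               ≡⟨ cong (d *_) (*-identityʳ d) ⟩
  d * d               ≤⟨ *-mono-≤ d≤y d≤y ⟩
  y * y               ≤⟨ y²≤ ⟩
  k * suc (suc m)     ≤⟨ *-monoʳ-≤ k (s≤s (m≤n+m (suc m) m)) ⟩
  k * (suc m + suc m) ≡⟨ double k (suc m) ⟩
  2 * k * suc m       ∎
  where
  open ≤-Reasoning
  double : ∀ k a → k * (a + a) ≡ 2 * k * a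
  double = solve-∀

theorem1 : (ℓ n : ℕ) → 1 ≤ ℓ → (G : Fin ℓ → Graph n) →
    Σ (Fin n → Bool) (λ side →
      (i : Fin ℓ) → (edges (G i) ∸ 2 * cut (G i) side) ^ 2 ≤ 2 * ℓ * edges (G i))
theorem1 ℓ n _ G = side , bound
  where
  m : Fin ℓ → ℕ
  m i = edges (G i)
  Y : Fin ℓ → Vector Bool n → ℕ
  Y i s = ∣ cutDeficit (G i) s ∣
  ∑Y²≤ : ∀ i → sumAll n (λ s → Y i s * Y i s) ≤ 2 ^ n * suc (m i)
  ∑Y²≤ i = ≤-trans (≤-reflexive (sumAll-∣cutDeficit∣² (G i))) (*-monoʳ-≤ (2 ^ n) (n≤1+n (m i)))
  markov : ∃[ s ] ∀ i → Y i s * Y i s ≤ ℓ * suc (m i)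
  markov = simultaneous-markov n (λ i s → Y i s * Y i s) (suc ∘ m) (λ _ → z<s) ∑Y²≤
  side : Fin n → Bool
  side = proj₁ markov
  bound : (i : Fin ℓ) → (m i ∸ 2 * cut (G i) side) ^ 2 ≤ 2 * ℓ * m i
  bound i = deficit²-bound ℓ (m∸n≤m (m i) c) (m∸n≤∣+m-+n∣ (m i) c) (proj₂ markov i)
    where
    c : ℕ
    c = 2 * cut (G i) side
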